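{- Let $G$ be a nontrivial cyclic group of order $n$, let $S$ be the set of all generators of $G$, and let $\Gamma(G)$ be the generator graph of $G$. Then the Wiener index of $\Gamma(G)$ is $$W(\Gamma(G)) = \tfrac{1}{2}|S|^2 - \tfrac{1}{2}(2n-1)|S| + n^2 - n.$$
   Context: For a group $G$, the generator graph $\Gamma(G)$ is the simple undirected graph whose vertex set is the set of elements of $G$, in which two distinct elements $x,y$ are adjacent if and only if at least one of them generates $G$ (i.e. $\langle x\rangle = G$ or $\langle y\rangle = G$). For a connected graph $\Gamma$, the Wiener index is $W(\Gamma) = \sum_{\{u,v\}\subseteq V(\Gamma)} d_\Gamma(u,v)$, the sum over all unordered pairs of distinct vertices of their distance. -}

module Defs where

open import Level using (Level; _⊔_)
open import Algebra.Bundles using (Group)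
open import Data.Nat as ℕ using (ℕ; zero; suc; _≤_; _<ᵇ_)
open import Data.Integer as ℤ using (ℤ; +_; -[1+_])
open import Data.Fin using (Fin; toℕ)
open import Data.Product using (Σ; ∃; _×_; _,_)
open import Data.Sum using (_⊎_)
open import Data.Bool using (if_then_else_)
open import Relation.Nullary using (¬_)
open import Relation.Binary.PropositionalEquality using (_≡_)

sumFin : (n : ℕ) → (Fin n → ℕ) → ℕ
sumFin zero    f = 0
sumFin (suc n) f = f Fin.zero ℕ.+ sumFin n (λ i → f (Fin.suc i))
  where import Data.Fin as Fin

module _ {c ℓ : Level} (G : Group c ℓ) where
  open Group G

  powℕ : Carrier → ℕ → Carrier
  powℕ x zero    = ε
  powℕ x (suc k) = x ∙ powℕ x k

  powℤ : Carrier → ℤ → Carrier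
  powℤ x (+ k)     = powℕ x k
  powℤ x -[1+ k ]  = (powℕ x (suc k)) ⁻¹

  Generates : Carrier → Set (c ⊔ ℓ)
  Generates x = ∀ y → ∃ λ (k : ℤ) → powℤ x k ≈ y

  IsCyclic : Set (c ⊔ ℓ)
  IsCyclic = ∃ λ g → Generates g

  -- e : Fin n → Carrier is a bijective enumeration of G (so |G| = n)
  Enumerates : (n : ℕ) → (Fin n → Carrier) → Set (c ⊔ ℓ)
  Enumerates n e = (∀ i j → e i ≈ e j → i ≡ j) × (∀ x → ∃ λ i → e i ≈ x)

  -- s is the number of generators: gens : Fin s → Fin n is a bijection
  -- onto the set of indices of generators
  GeneratorCount : (n : ℕ) → (Fin n → Carrier) → ℕ → Set (c ⊔ ℓ)
  GeneratorCount n e s = Σ (Fin s → Fin n) λ gens →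
    (∀ t u → gens t ≡ gens u → t ≡ u) ×
    (∀ i → (Generates (e i) → ∃ λ t → gens t ≡ i) × (∀ t → gens t ≡ i → Generates (e i)))

  Adj : (n : ℕ) → (Fin n → Carrier) → Fin n → Fin n → Set (c ⊔ ℓ)
  Adj n e i j = ¬ (i ≡ j) × (Generates (e i) ⊎ Generates (e j))

  data Walk (n : ℕ) (e : Fin n → Carrier) : ℕ → Fin n → Fin n → Set (c ⊔ ℓ) where
    here : ∀ {u} → Walk n e 0 u u
    step : ∀ {k u w v} → Adj n e u w → Walk n e k w v → Walk n e (suc k) u v

  IsDistance : (n : ℕ) → (Fin n → Carrier) → (Fin n → Fin n → ℕ) → Set (c ⊔ ℓ)
  IsDistance n e d = ∀ u v → Walk n e (d u v) u v × (∀ k → Walk n e k u v → d u v ≤ k)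

wiener : (n : ℕ) → (Fin n → Fin n → ℕ) → ℕ
wiener n d = sumFin n (λ i → sumFin n (λ j → if toℕ i <ᵇ toℕ j then d i j else 0))

{-# OPTIONS --safe #-}
module Submission where

-- Every generator is adjacent to every other vertex of Γ(G), while two distinct
-- non-generators are not adjacent but are joined through any generator, and one
-- exists because G is cyclic. So with b the indicator of the non-generators,
-- d(u, v) = 1 + b(u) b(v) for u ≠ v, and summing over ordered pairs of distinct
-- vertices gives 2 W = n (n - 1) + m (m - 1), where m = n - s is the number of
-- non-generators.

open import Defs
open import Level using (Level)
open import Algebra.Bundles using (Group)
open import Data.Nat using (ℕ; _≤_; zero; suc; z≤n; s≤s)
open import Data.Nat.Properties using (+-*-semiring; +-commutativeSemigroup; ≤-antisym)
open import Algebra.Properties.Semiring.Sum +-*-semiring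
  using ( sum; sum-syntax; sum-cong-≗; sum-remove; sum-replicate-zero
        ; ∑-distrib-+; ∑-comm; *-distribˡ-sum; *-distribʳ-sum)
open import Algebra.Properties.CommutativeSemigroup +-commutativeSemigroup using (xy∙z≈zy∙x)
open import Data.Fin using (Fin; zero; suc; toℕ; punchIn)
open import Data.Fin.Properties using (_≟_; any?; toℕ-injective; punchInᵢ≢i)
import Data.Integer as ℤ
open import Data.Bool using (true; false; if_then_else_)
open import Data.Product using (∃; _×_; _,_; proj₁; proj₂)
open import Data.Sum using (inj₁; inj₂)
open import Function using (_∘_)
open import Relation.Nullary using (Dec; yes; no; ¬_)
open import Relation.Nullary.Decidable using (¬?; map′)
open import Relation.Nullary.Negation using (contradiction)
open import Relation.Nullary.Reflects using (ofʸ; ofⁿ)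
open import Relation.Binary.PropositionalEquality
  using (_≡_; _≢_; refl; sym; trans; cong; cong₂; subst; module ≡-Reasoning)

module FiniteSums where
  open import Data.Nat using (_+_; _*_; _<ᵇ_)
  open import Data.Nat.Properties using (+-identityʳ; *-identityʳ; <ᵇ-reflects-<; <⇒≯; ≮⇒≥)
  open ≡-Reasoning

  indicator : ∀ {p} {P : Set p} → Dec P → ℕ
  indicator (yes _) = 1
  indicator (no _)  = 0

  indicator-yes : ∀ {p} {P : Set p} → P → (P? : Dec P) → indicator P? ≡ 1
  indicator-yes _ (yes _) = refl
  indicator-yes p (no ¬p) = contradiction p ¬p

  indicator-no : ∀ {p} {P : Set p} → ¬ P → (P? : Dec P) → indicator P? ≡ 0
  indicator-no ¬p (yes p) = contradiction p ¬p
  indicator-no _  (no _)  = refl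

  indicator-idem : ∀ {p} {P : Set p} (P? : Dec P) → indicator P? * indicator P? ≡ indicator P?
  indicator-idem (yes _) = refl
  indicator-idem (no _)  = refl

  indicator-¬?+indicator : ∀ {p} {P : Set p} (P? : Dec P) → indicator (¬? P?) + indicator P? ≡ 1
  indicator-¬?+indicator (yes _) = refl
  indicator-¬?+indicator (no _)  = refl

  sumFin≡sum : ∀ n (f : Fin n → ℕ) → sumFin n f ≡ sum f
  sumFin≡sum zero    f = refl
  sumFin≡sum (suc n) f = cong (f zero +_) (sumFin≡sum n (f ∘ suc))

  sum-const : ∀ n c → ∑[ i < n ] c ≡ n * c
  sum-const zero    c = refl
  sum-const (suc n) c = cong (c +_) (sum-const n c)

  sum-suc : ∀ {n} (f : Fin n → ℕ) → ∑[ i < n ] suc (f i) ≡ n + sum f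
  sum-suc {n} f =
    trans (∑-distrib-+ (λ _ → 1) f) (cong (_+ sum f) (trans (sum-const n 1) (*-identityʳ n)))

  sum-differOnlyAt : ∀ {n} (i : Fin n) (f g : Fin n → ℕ) → (∀ j → j ≢ i → f j ≡ g j) →
                     sum f + g i ≡ sum g + f i
  sum-differOnlyAt {suc n} i f g f≡g = begin
    sum f + g i                      ≡⟨ cong (_+ g i) (sum-remove {i = i} f) ⟩
    f i + sum (f ∘ punchIn i) + g i  ≡⟨ cong (λ x → f i + x + g i) (sum-cong-≗ λ k →
                                          f≡g (punchIn i k) (punchInᵢ≢i i k)) ⟩
    f i + sum (g ∘ punchIn i) + g i  ≡⟨ xy∙z≈zy∙x (f i) _ (g i) ⟩
    g i + sum (g ∘ punchIn i) + f i  ≡⟨ cong (_+ f i) (sum-remove {i = i} g) ⟨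
    sum g + f i                      ∎

  sum-indicator-≟ : ∀ {n} (i : Fin n) → ∑[ j < n ] indicator (i ≟ j) ≡ 1
  sum-indicator-≟ {n} i = begin
    ∑[ j < n ] indicator (i ≟ j)      ≡⟨ +-identityʳ _ ⟨
    ∑[ j < n ] indicator (i ≟ j) + 0  ≡⟨ sum-differOnlyAt i _ (λ _ → 0) (λ j j≢i →
                                           indicator-no (j≢i ∘ sym) (i ≟ j)) ⟩
    ∑[ j < n ] 0 + indicator (i ≟ i)  ≡⟨ cong₂ _+_ (sum-replicate-zero n) (indicator-yes refl (i ≟ i)) ⟩
    1                                 ∎

  sum-indicator-image : ∀ {p s n} {P : Fin n → Set p} (P? : ∀ i → Dec (P i)) (f : Fin s → Fin n) →
                        (∀ {t u} → f t ≡ f u → t ≡ u) → (∀ t → P (f t)) →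
                        (∀ i → P i → ∃ λ t → f t ≡ i) →
                        ∑[ i < n ] indicator (P? i) ≡ s
  sum-indicator-image {s = s} {n} {P} P? f f-injective P-image onto-P = begin
    ∑[ i < n ] indicator (P? i)                 ≡⟨ sum-cong-≗ fibre-size ⟩
    ∑[ i < n ] ∑[ t < s ] indicator (f t ≟ i)  ≡⟨ ∑-comm (λ i t → indicator (f t ≟ i)) ⟩
    ∑[ t < s ] ∑[ i < n ] indicator (f t ≟ i)  ≡⟨ sum-cong-≗ (sum-indicator-≟ ∘ f) ⟩
    ∑[ t < s ] 1                                ≡⟨ trans (sum-const s 1) (*-identityʳ s) ⟩
    s                                           ∎
    where
    fibre-size : ∀ i → indicator (P? i) ≡ ∑[ t < s ] indicator (f t ≟ i)
    fibre-size i with P? i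
    ... | yes Pi = sym (trans (sum-cong-≗ in-fibre≡at-t₀) (sum-indicator-≟ t₀))
      where
      t₀ : Fin s
      t₀ = proj₁ (onto-P i Pi)
      in-fibre≡at-t₀ : ∀ t → indicator (f t ≟ i) ≡ indicator (t₀ ≟ t)
      in-fibre≡at-t₀ t with f t ≟ i | t₀ ≟ t
      ... | yes ft≡i | no t₀≢t  = contradiction (f-injective (trans (proj₂ (onto-P i Pi)) (sym ft≡i))) t₀≢t
      ... | no ft≢i  | yes refl = contradiction (proj₂ (onto-P i Pi)) ft≢i
      ... | yes _    | yes _    = refl
      ... | no _     | no _     = refl
    ... | no ¬Pi = sym (trans (sum-cong-≗ λ t → indicator-no (¬Pi ∘ λ ft≡i → subst P ft≡i (P-image t)) (f t ≟ i))
                              (sum-replicate-zero s))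

  strictUpper : ∀ {n} → (Fin n → Fin n → ℕ) → Fin n → Fin n → ℕ
  strictUpper d i j = if toℕ i <ᵇ toℕ j then d i j else 0

  wiener≡∑∑strictUpper : ∀ n (d : Fin n → Fin n → ℕ) →
                         wiener n d ≡ ∑[ i < n ] ∑[ j < n ] strictUpper d i j
  wiener≡∑∑strictUpper n d =
    trans (sumFin≡sum n (λ i → sumFin n (strictUpper d i))) (sum-cong-≗ λ i → sumFin≡sum n (strictUpper d i))

  wiener-cong : ∀ n {d d′ : Fin n → Fin n → ℕ} → (∀ i j → d i j ≡ d′ i j) → wiener n d ≡ wiener n d′
  wiener-cong n {d} {d′} d≗d′ = begin
    wiener n d                                ≡⟨ wiener≡∑∑strictUpper n d ⟩
    ∑[ i < n ] ∑[ j < n ] strictUpper d i j   ≡⟨ sum-cong-≗ (λ i → sum-cong-≗ λ j →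
                                                   cong (λ x → if toℕ i <ᵇ toℕ j then x else 0) (d≗d′ i j)) ⟩
    ∑[ i < n ] ∑[ j < n ] strictUpper d′ i j  ≡⟨ wiener≡∑∑strictUpper n d′ ⟨
    wiener n d′                               ∎

  strictUpper-split : ∀ {n} (d : Fin n → Fin n → ℕ) → (∀ i j → d i j ≡ d j i) → (∀ i → d i i ≡ 0) →
                      ∀ i j → d i j ≡ strictUpper d i j + strictUpper d j i
  strictUpper-split d d-sym d-diag i j
    with toℕ i <ᵇ toℕ j | <ᵇ-reflects-< (toℕ i) (toℕ j) | toℕ j <ᵇ toℕ i | <ᵇ-reflects-< (toℕ j) (toℕ i)
  ... | true  | ofʸ i<j | true  | ofʸ j<i = contradiction j<i (<⇒≯ i<j)
  ... | true  | _       | false | _       = sym (+-identityʳ (d i j))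
  ... | false | _       | true  | _       = d-sym i j
  ... | false | ofⁿ i≮j | false | ofⁿ j≮i
    with refl ← toℕ-injective {i = i} {j} (≤-antisym (≮⇒≥ j≮i) (≮⇒≥ i≮j)) = d-diag i

  ∑∑≡2*wiener : ∀ n (d : Fin n → Fin n → ℕ) → (∀ i j → d i j ≡ d j i) → (∀ i → d i i ≡ 0) →
                ∑[ i < n ] ∑[ j < n ] d i j ≡ 2 * wiener n d
  ∑∑≡2*wiener n d d-sym d-diag = begin
    ∑[ i < n ] ∑[ j < n ] d i j
      ≡⟨ sum-cong-≗ (λ i → trans (sum-cong-≗ (strictUpper-split d d-sym d-diag i))
                                 (∑-distrib-+ (U i) (λ j → U j i))) ⟩
    ∑[ i < n ] (∑[ j < n ] U i j + ∑[ j < n ] U j i)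
      ≡⟨ ∑-distrib-+ (λ i → ∑[ j < n ] U i j) (λ i → ∑[ j < n ] U j i) ⟩
    ∑[ i < n ] ∑[ j < n ] U i j + ∑[ i < n ] ∑[ j < n ] U j i
      ≡⟨ cong (∑[ i < n ] ∑[ j < n ] U i j +_) (∑-comm (λ i j → U j i)) ⟩
    ∑[ i < n ] ∑[ j < n ] U i j + ∑[ j < n ] ∑[ i < n ] U j i
      ≡⟨ cong₂ _+_ ∑∑U≡W (trans ∑∑U≡W (sym (+-identityʳ (wiener n d)))) ⟩
    2 * wiener n d
      ∎
    where
    U : Fin n → Fin n → ℕ
    U = strictUpper d
    ∑∑U≡W : ∑[ i < n ] ∑[ j < n ] U i j ≡ wiener n d
    ∑∑U≡W = sym (wiener≡∑∑strictUpper n d)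

open FiniteSums

module _ {c ℓ : Level} (G : Group c ℓ) where
  open Group G using (_≈_; ∙-cong; ⁻¹-cong) renaming (refl to ≈-refl; sym to ≈-sym; trans to ≈-trans)

  powℕ-cong : ∀ {x y} → x ≈ y → ∀ k → powℕ G x k ≈ powℕ G y k
  powℕ-cong x≈y zero    = ≈-refl
  powℕ-cong x≈y (suc k) = ∙-cong x≈y (powℕ-cong x≈y k)

  powℤ-cong : ∀ {x y} → x ≈ y → ∀ k → powℤ G x k ≈ powℤ G y k
  powℤ-cong x≈y (ℤ.+ k)      = powℕ-cong x≈y k
  powℤ-cong x≈y (ℤ.-[1+ k ]) = ⁻¹-cong (powℕ-cong x≈y (suc k))

  Generates-resp : ∀ {x y} → x ≈ y → Generates G x → Generates G y
  Generates-resp x≈y x-generates z with x-generates z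
  ... | k , xᵏ≈z = k , ≈-trans (powℤ-cong (≈-sym x≈y) k) xᵏ≈z

  walk-between-distinct⇒1≤length : ∀ {n e u v k} → u ≢ v → Walk G n e k u v → 1 ≤ k
  walk-between-distinct⇒1≤length u≢v here       = contradiction refl u≢v
  walk-between-distinct⇒1≤length u≢v (step _ _) = s≤s z≤n

  IsDistance-unique : ∀ {n e} {d d′ : Fin n → Fin n → ℕ} → IsDistance G n e d → IsDistance G n e d′ →
                      ∀ u v → d u v ≡ d′ u v
  IsDistance-unique d-dist d′-dist u v =
    ≤-antisym (proj₂ (d-dist u v) _ (proj₁ (d′-dist u v))) (proj₂ (d′-dist u v) _ (proj₁ (d-dist u v)))

module GeneratorGraph {c ℓ : Level} (G : Group c ℓ) {n : ℕ} (e : Fin n → Group.Carrier G)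
  (enumerates : Enumerates G n e) (cyclic : IsCyclic G) {s : ℕ} (count : GeneratorCount G n e s) where
  open import Data.Nat using (_+_; _*_)
  open import Data.Nat.Properties using (+-identityʳ; *-identityʳ; *-comm)
  open ≡-Reasoning

  gens : Fin s → Fin n
  gens = proj₁ count

  gens-injective : ∀ {t u} → gens t ≡ gens u → t ≡ u
  gens-injective = proj₁ (proj₂ count) _ _

  generator⇒inImage : ∀ i → Generates G (e i) → ∃ λ t → gens t ≡ i
  generator⇒inImage i = proj₁ (proj₂ (proj₂ count) i)

  inImage⇒generator : ∀ i → (∃ λ t → gens t ≡ i) → Generates G (e i)
  inImage⇒generator i (t , gens-t≡i) = proj₂ (proj₂ (proj₂ count) i) t gens-t≡i

  isGenerator? : ∀ i → Dec (Generates G (e i))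
  isGenerator? i = map′ (inImage⇒generator i) (generator⇒inImage i) (any? λ t → gens t ≟ i)

  g₀ : Fin n
  g₀ = proj₁ (proj₂ enumerates (proj₁ cyclic))

  g₀-generates : Generates G (e g₀)
  g₀-generates = Generates-resp G (Group.sym G (proj₂ (proj₂ enumerates (proj₁ cyclic)))) (proj₂ cyclic)

  nonGenerator : Fin n → ℕ
  nonGenerator i = indicator (¬? (isGenerator? i))

  nonGeneratorCount : ℕ
  nonGeneratorCount = sum nonGenerator

  nonGeneratorCount+s≡n : nonGeneratorCount + s ≡ n
  nonGeneratorCount+s≡n = begin
    sum nonGenerator + s                                      ≡⟨ cong (sum nonGenerator +_) generatorCount ⟨
    sum nonGenerator + ∑[ i < n ] indicator (isGenerator? i)  ≡⟨ ∑-distrib-+ nonGenerator _ ⟨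
    ∑[ i < n ] (nonGenerator i + indicator (isGenerator? i))  ≡⟨ sum-cong-≗ (indicator-¬?+indicator ∘ isGenerator?) ⟩
    ∑[ i < n ] 1                                              ≡⟨ trans (sum-const n 1) (*-identityʳ n) ⟩
    n                                                         ∎
    where
    generatorCount : ∑[ i < n ] indicator (isGenerator? i) ≡ s
    generatorCount = sum-indicator-image isGenerator? gens gens-injective
                       (λ t → inImage⇒generator (gens t) (t , refl)) generator⇒inImage

  distance : Fin n → Fin n → ℕ
  distance u v with u ≟ v
  ... | yes _ = 0
  ... | no _  = suc (nonGenerator u * nonGenerator v)

  distance-isDistance : IsDistance G n e distance
  distance-isDistance u v with u ≟ v
  ... | yes refl = here , λ _ _ → z≤n
  ... | no u≢v with isGenerator? u | isGenerator? v
  ...   | yes u-gen | _         = step (u≢v , inj₁ u-gen) here , λ _ → walk-between-distinct⇒1≤length G u≢v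
  ...   | no _      | yes v-gen = step (u≢v , inj₂ v-gen) here , λ _ → walk-between-distinct⇒1≤length G u≢v
  ...   | no ¬u-gen | no ¬v-gen =
    step (u≢g₀ , inj₂ g₀-generates) (step (g₀≢v , inj₁ g₀-generates) here) , 2≤length
    where
    u≢g₀ : u ≢ g₀
    u≢g₀ refl = ¬u-gen g₀-generates
    g₀≢v : g₀ ≢ v
    g₀≢v refl = ¬v-gen g₀-generates
    2≤length : ∀ k → Walk G n e k u v → 2 ≤ k
    2≤length _ here                         = contradiction refl u≢v
    2≤length _ (step (_ , inj₁ u-gen) here) = contradiction u-gen ¬u-gen
    2≤length _ (step (_ , inj₂ v-gen) here) = contradiction v-gen ¬v-gen
    2≤length _ (step _ (step _ _))          = s≤s (s≤s z≤n)

  distance-self : ∀ u → distance u u ≡ 0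
  distance-self u with u ≟ u
  ... | yes _  = refl
  ... | no u≢u = contradiction refl u≢u

  distance-≢ : ∀ {u v} → u ≢ v → distance u v ≡ suc (nonGenerator u * nonGenerator v)
  distance-≢ {u} {v} u≢v with u ≟ v
  ... | yes u≡v = contradiction u≡v u≢v
  ... | no _    = refl

  distance-sym : ∀ u v → distance u v ≡ distance v u
  distance-sym u v with u ≟ v
  ... | yes refl = sym (distance-self u)
  ... | no u≢v   = begin
    suc (nonGenerator u * nonGenerator v)  ≡⟨ cong suc (*-comm (nonGenerator u) (nonGenerator v)) ⟩
    suc (nonGenerator v * nonGenerator u)  ≡⟨ distance-≢ (u≢v ∘ sym) ⟨
    distance v u                           ∎

  row-sum : ∀ i → ∑[ j < n ] distance i j + suc (nonGenerator i) ≡ n + nonGenerator i * nonGeneratorCount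
  row-sum i = begin
    sum (distance i) + suc (b i)               ≡⟨ cong (λ x → sum (distance i) + suc x)
                                                       (indicator-idem (¬? (isGenerator? i))) ⟨
    sum (distance i) + suc (b i * b i)         ≡⟨ sum-differOnlyAt i (distance i) (λ j → suc (b i * b j))
                                                       (λ j j≢i → distance-≢ (j≢i ∘ sym)) ⟩
    ∑[ j < n ] suc (b i * b j) + distance i i  ≡⟨ trans (cong (∑[ j < n ] suc (b i * b j) +_) (distance-self i))
                                                       (+-identityʳ _) ⟩
    ∑[ j < n ] suc (b i * b j)                 ≡⟨ sum-suc (λ j → b i * b j) ⟩
    n + ∑[ j < n ] (b i * b j)                 ≡⟨ cong (n +_) (*-distribˡ-sum (b i) b) ⟨
    n + b i * nonGeneratorCount                ∎
    where
    b : Fin n → ℕ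
    b = nonGenerator

  wiener-distance : 2 * wiener n distance + (n + nonGeneratorCount) ≡
                    n * n + nonGeneratorCount * nonGeneratorCount
  wiener-distance = begin
    2 * wiener n distance + (n + m)
      ≡⟨ cong₂ _+_ (∑∑≡2*wiener n distance distance-sym distance-self) (sum-suc nonGenerator) ⟨
    ∑[ i < n ] ∑[ j < n ] distance i j + ∑[ i < n ] suc (nonGenerator i)
      ≡⟨ ∑-distrib-+ (λ i → ∑[ j < n ] distance i j) (suc ∘ nonGenerator) ⟨
    ∑[ i < n ] (∑[ j < n ] distance i j + suc (nonGenerator i))
      ≡⟨ sum-cong-≗ row-sum ⟩
    ∑[ i < n ] (n + nonGenerator i * m)
      ≡⟨ ∑-distrib-+ (λ _ → n) (λ i → nonGenerator i * m) ⟩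
    ∑[ i < n ] n + ∑[ i < n ] (nonGenerator i * m)
      ≡⟨ cong₂ _+_ (sum-const n n) (sym (*-distribʳ-sum m nonGenerator)) ⟩
    n * n + m * m
      ∎
    where
    m : ℕ
    m = nonGeneratorCount

open import Data.Integer using (+_; _-_; _*_; _+_)
open import Data.Integer.Properties using (+-0-abelianGroup; pos-+; pos-*)
open import Algebra.Properties.AbelianGroup +-0-abelianGroup using () renaming (∙-cancelʳ to +-cancelʳ)
open import Data.Integer.Tactic.RingSolver using (solve-∀)
import Data.Nat as ℕ

wiener-formula : ∀ {W n m s : ℕ} → m ℕ.+ s ≡ n → 2 ℕ.* W ℕ.+ (n ℕ.+ m) ≡ n ℕ.* n ℕ.+ m ℕ.* m →
                 + 2 * + W ≡ (+ s * + s - (+ 2 * + n - + 1) * + s) + + 2 * (+ n * + n - + n)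
wiener-formula {W} {n} {m} {s} m+s≡n counted = solve-for-w (+ 2 * + W) (+ n) (+ m) (+ s) n≡m+s counted-in-ℤ
  where
  open ≡-Reasoning
  n≡m+s : + n ≡ + m + + s
  n≡m+s = trans (cong +_ (sym m+s≡n)) (pos-+ m s)
  counted-in-ℤ : + 2 * + W + (+ n + + m) ≡ + n * + n + + m * + m
  counted-in-ℤ = begin
    + 2 * + W + (+ n + + m)    ≡⟨ cong₂ _+_ (pos-* 2 W) (pos-+ n m) ⟨
    + (2 ℕ.* W) + + (n ℕ.+ m)  ≡⟨ pos-+ (2 ℕ.* W) (n ℕ.+ m) ⟨
    + (2 ℕ.* W ℕ.+ (n ℕ.+ m))  ≡⟨ cong +_ counted ⟩
    + (n ℕ.* n ℕ.+ m ℕ.* m)    ≡⟨ pos-+ (n ℕ.* n) (m ℕ.* m) ⟩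
    + (n ℕ.* n) + + (m ℕ.* m)  ≡⟨ cong₂ _+_ (pos-* n n) (pos-* m m) ⟩
    + n * + n + + m * + m      ∎
  solve-for-w : ∀ w n m s → n ≡ m + s → w + (n + m) ≡ n * n + m * m →
                w ≡ (s * s - (+ 2 * n - + 1) * s) + + 2 * (n * n - n)
  solve-for-w w .(m + s) m s refl counted = +-cancelʳ (m + s + m) w _ (trans counted (expand m s))
    where
    expand : ∀ m s → (m + s) * (m + s) + m * m ≡
                     (s * s - (+ 2 * (m + s) - + 1) * s) + + 2 * ((m + s) * (m + s) - (m + s)) + (m + s + m)
    expand = solve-∀

theorem4p1 : ∀ {c ℓ : Level} (G : Group c ℓ) (n : ℕ) → 2 ≤ n →
    (e : Fin n → Group.Carrier G) → Enumerates G n e → IsCyclic G →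
    (s : ℕ) → GeneratorCount G n e s →
    (∃ λ d → IsDistance G n e d) ×
    (∀ d → IsDistance G n e d →
      + 2 * + wiener n d ≡
        (+ s * + s - (+ 2 * + n - + 1) * + s) + + 2 * (+ n * + n - + n))
theorem4p1 G n _ e enumerates cyclic s count = (distance , distance-isDistance) , wiener-of-distance
  where
  open GeneratorGraph G e enumerates cyclic count
  wiener-of-distance : ∀ d → IsDistance G n e d →
    + 2 * + wiener n d ≡ (+ s * + s - (+ 2 * + n - + 1) * + s) + + 2 * (+ n * + n - + n)
  wiener-of-distance d d-isDistance =
    trans (cong (λ w → + 2 * + w) (wiener-cong n (IsDistance-unique G d-isDistance distance-isDistance)))
          (wiener-formula {W = wiener n distance} {m = nonGeneratorCount} nonGeneratorCount+s≡n wiener-distance)
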